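{- Let $G$ be a nilpotent finite group, $N$ a cyclic normal subgroup of $G$ containing $G'$, and $S\subseteq G$ such that $\overline S$ is a minimal generating set of $\overline G=G/N$ with $\#S=\#\overline S\ge2$. Let $C_1$ and $C_2$ be two disjoint oriented cycles in $\mathrm{Cay}(\overline G;\overline S)$, let $g\in G$ and $a,s\in S$, and suppose $C_1$ contains the oriented edge $\overline g(s)$ and $C_2$ contains the oriented edge $\overline{gsa}(s^{ -1})$. If $N\subseteq Z(G)$, then $\Pi(C_1\mathbin{\#}_s^a C_2)=(\Pi C_1)(\Pi C_2)[a,s]$.
   Context: $g\mapsto\overline g$ is the natural map $G\to\overline G$. $\mathrm{Cay}(\overline G;\overline S)$ has vertex set $\overline G$ and edges $\overline g$—$\overline{gt}$, $t\in S$. For $\overline g\in\overline G$ and a sequence $(s_1,\dots,s_n)$ of elements of $S\cup S^{ -1}$, $\overline g(s_i)_{i=1}^n$ denotes the walk visiting $\overline g,\overline{gs_1},\overline{gs_1s_2},\dots,\overline{gs_1\cdots s_n}$; in particular $\overline g(s)$ is the oriented edge from $\overline g$ to $\overline{gs}$. If such a walk is an oriented cycle $C$, its voltage is $\Pi C=s_1\cdots s_n\in N$ (when $N\subseteq Z(G)$ this does not depend on the chosen starting point). The connected sum $C_1\mathbin{\#}_s^aC_2$ is the oriented cycle obtained from $C_1\cup C_2$ by removing the oriented edges $\overline g(s)$ and $\overline{gsa}(s^{ -1})$ and inserting the oriented edges $\overline g(a)$ and $\overline{gsa}(a^{ -1})$. $[a,s]=a^{ -1}s^{ -1}as$. -}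

module Defs where

open import Level using (Level; _⊔_; 0ℓ)
open import Algebra.Bundles using (Group)
open import Data.Nat using (ℕ; zero; suc; _≤_)
open import Data.Integer using (ℤ; +_; -[1+_])
open import Data.Fin using (Fin)
import Data.Fin.Subset as Sub
open import Data.Bool using (Bool; true; false)
open import Data.List using (List; []; _∷_; _++_; length)
open import Data.List.Relation.Unary.All using (All)
open import Data.List.Relation.Unary.AllPairs using (AllPairs)
open import Data.List.Membership.Propositional using (_∈_)
open import Data.Product using (Σ; ∃; ∃₂; _×_; _,_; proj₁; proj₂)
open import Data.Unit.Polymorphic using (⊤)
open import Relation.Nullary using (¬_)
open import Relation.Binary.PropositionalEquality using (_≡_)

module GroupTheory {c ℓ} (G : Group c ℓ) where
  open Group G

  -- commutator, paper's convention: [x , y] = x⁻¹ y⁻¹ x y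
  ⁅_,_⁆ : Carrier → Carrier → Carrier
  ⁅ x , y ⁆ = x ⁻¹ ∙ y ⁻¹ ∙ x ∙ y

  _^ℕ_ : Carrier → ℕ → Carrier
  x ^ℕ zero = ε
  x ^ℕ suc n = x ∙ (x ^ℕ n)

  _^ℤ_ : Carrier → ℤ → Carrier
  x ^ℤ (+ n) = x ^ℕ n
  x ^ℤ -[1+ n ] = (x ^ℕ suc n) ⁻¹

  data ⟨_⟩ (P : Carrier → Set (c ⊔ ℓ)) : Carrier → Set (c ⊔ ℓ) where
    gen  : ∀ {x} → P x → ⟨ P ⟩ x
    one  : ⟨ P ⟩ ε
    mul  : ∀ {x y} → ⟨ P ⟩ x → ⟨ P ⟩ y → ⟨ P ⟩ (x ∙ y)
    inv  : ∀ {x} → ⟨ P ⟩ x → ⟨ P ⟩ (x ⁻¹)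
    resp : ∀ {x y} → x ≈ y → ⟨ P ⟩ x → ⟨ P ⟩ y

  -- lower central series, shifted: γ i is γ_{i+1};
  -- γ 0 = G, γ (i+1) = [γ i , G]; in particular γ 1 = G' (derived subgroup)
  γ : ℕ → Carrier → Set (c ⊔ ℓ)
  γ zero _ = ⊤
  γ (suc i) = ⟨ (λ z → ∃₂ λ x y → γ i x × z ≈ ⁅ x , y ⁆) ⟩

  IsNilpotent : Set (c ⊔ ℓ)
  IsNilpotent = ∃ λ n → ∀ x → γ n x → x ≈ ε

  IsFinite : Set (c ⊔ ℓ)
  IsFinite = ∃ λ n → Σ (Fin n → Carrier) λ f → ∀ x → ∃ λ i → f i ≈ x

  IsCentral : Carrier → Set (c ⊔ ℓ)
  IsCentral z = ∀ x → z ∙ x ≈ x ∙ z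

  record IsNormalSubgroup {p} (N : Carrier → Set p) : Set (c ⊔ ℓ ⊔ p) where
    field
      N-resp : ∀ {x y} → x ≈ y → N x → N y
      N-ε    : N ε
      N-∙    : ∀ {x y} → N x → N y → N (x ∙ y)
      N-⁻¹   : ∀ {x} → N x → N (x ⁻¹)
      N-conj : ∀ g {x} → N x → N (g ⁻¹ ∙ x ∙ g)

  IsCyclic : ∀ {p} → (Carrier → Set p) → Set (c ⊔ ℓ ⊔ p)
  IsCyclic N = ∃ λ z → N z × (∀ x → N x → ∃ λ k → x ≈ z ^ℤ k)

  module Quotient {p} (N : Carrier → Set p) where

    -- x̄ = ȳ in G/N
    _~_ : Carrier → Carrier → Set p
    x ~ y = N (x ⁻¹ ∙ y)

    module Gens {k : ℕ} (S : Fin k → Carrier) where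

      -- an element of S ∪ S⁻¹ : (i , true) is S i, (i , false) is (S i)⁻¹
      Step : Set
      Step = Fin k × Bool

      val : Step → Carrier
      val (i , true)  = S i
      val (i , false) = S i ⁻¹

      -- product s₁ ⋯ sₙ (the voltage of a cycle traversed with these steps)
      Π : List Step → Carrier
      Π []      = ε
      Π (t ∷ w) = val t ∙ Π w

      Generates : Sub.Subset k → Set (c ⊔ p)
      Generates T = ∀ g → ∃ λ w → All (λ t → proj₁ t Sub.∈ T) w × (Π w ~ g)

      IsMinimalGeneratingSet : Set (c ⊔ p)
      IsMinimalGeneratingSet = Generates Sub.⊤ × (∀ T → Generates T → T ≡ Sub.⊤)

      -- the walk ḡ(s₁,…,sₙ) in Cay(G/N; S̄): vertices visited (without the final one)
      verts : Carrier → List Step → List Carrier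
      verts v []      = []
      verts v (t ∷ w) = v ∷ verts (v ∙ val t) w

      -- underlying (unoriented) edge of the oriented edge v̄(t): edge x̄—x̄sᵢ labelled i
      edgeOf : Carrier → Step → Carrier × Fin k
      edgeOf v (i , true)  = v , i
      edgeOf v (i , false) = v ∙ S i ⁻¹ , i

      edges : Carrier → List Step → List (Carrier × Fin k)
      edges v []      = []
      edges v (t ∷ w) = edgeOf v t ∷ edges (v ∙ val t) w

      record IsOrientedCycle (v : Carrier) (w : List Step) : Set (c ⊔ p) where
        field
          nonempty      : 1 ≤ length w
          closed        : (v ∙ Π w) ~ v
          distinctVerts : AllPairs (λ x y → ¬ (x ~ y)) (verts v w)
          distinctEdges : AllPairs (λ e f → ¬ ((proj₁ e ~ proj₁ f) × proj₂ e ≡ proj₂ f)) (edges v w)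

      Disjoint : Carrier → List Step → Carrier → List Step → Set (c ⊔ p)
      Disjoint v w v' w' = ∀ {x y} → x ∈ verts v w → y ∈ verts v' w' → ¬ (x ~ y)

      -- the cycle v̄(w) contains the oriented edge x̄(t), at the position |pre|
      record ContainsEdge (v : Carrier) (w : List Step) (x : Carrier) (t : Step) : Set (c ⊔ p) where
        field
          pre  : List Step
          post : List Step
          split : w ≡ pre ++ t ∷ post
          at    : (v ∙ Π pre) ~ x

      -- C₁ #ₛᵃ C₂, written as the walk starting at ḡ:
      -- ḡ(a), then C₂ from ḡsa(s⁻¹)'s head ḡa round to ḡsa, then (a⁻¹) to ḡs,
      -- then C₁ from ḡs round to ḡ.
      connSum : ∀ {v₁ w₁ x₁ t₁ v₂ w₂ x₂ t₂} (a : Fin k) →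
                ContainsEdge v₁ w₁ x₁ t₁ → ContainsEdge v₂ w₂ x₂ t₂ → List Step
      connSum a e₁ e₂ =
        (a , true) ∷ ContainsEdge.post e₂ ++ ContainsEdge.pre e₂
          ++ (a , false) ∷ ContainsEdge.post e₁ ++ ContainsEdge.pre e₁

module Submission where

-- Writing the two cycles as C₁ = P₁ (s) Q₁ and C₂ = P₂ (s⁻¹) Q₂ (prefix, the
-- distinguished edge, suffix), the connected sum C₁ #ₛᵃ C₂ is the walk
-- (a) Q₂ P₂ (a⁻¹) Q₁ P₁.  Voltages of closed walks lie in N, hence are central,
-- and a central product is invariant under cyclic rotation:  if z = p r is
-- central then r p = z.  Rotating the cycles gives Q₁ P₁ = s⁻¹ ΠC₁ and
-- Q₂ P₂ = s ΠC₂, so the voltage of the connected sum is a s ΠC₂ a⁻¹ s⁻¹ ΠC₁,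
-- which equals (a s a⁻¹ s⁻¹) ΠC₁ ΠC₂ = ΠC₁ ΠC₂ [a,s] once the central factor
-- ΠC₂ is moved out and the (central) commutator is recognised.

open import Defs
open import Algebra.Bundles using (Group)
open import Data.Nat using (ℕ; _≤_)
open import Data.Fin using (Fin)
open import Data.Bool using (true; false)
open import Data.List using (List; []; _∷_; _++_)
open import Data.Product using (_,_)
open import Relation.Binary.PropositionalEquality using (_≡_; cong)
import Relation.Binary.Reasoning.Setoid as SetoidReasoning
import Algebra.Properties.Group as GroupProperties

module GroupLemmas {c ℓ} (G : Group c ℓ) where
  open Group G
  open GroupTheory G using (IsCentral; ⁅_,_⁆)
  open GroupProperties G using (\\-leftDividesʳ; //-rightDividesˡ; ⁻¹-involutive)
  open SetoidReasoning setoid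

  -- A central product is invariant under swapping its two factors;
  -- this is what makes voltages of central cycles independent of the base point.
  central-swap : ∀ {z p r} → IsCentral z → z ≈ p ∙ r → r ∙ p ≈ z
  central-swap {z} {p} {r} central-z z≈pr = begin
    r ∙ p                 ≈⟨ ∙-congʳ (\\-leftDividesʳ p r) ⟨
    p ⁻¹ ∙ (p ∙ r) ∙ p    ≈⟨ ∙-congʳ (∙-congˡ z≈pr) ⟨
    p ⁻¹ ∙ z ∙ p          ≈⟨ assoc _ _ _ ⟩
    p ⁻¹ ∙ (z ∙ p)        ≈⟨ ∙-congˡ (central-z p) ⟩
    p ⁻¹ ∙ (p ∙ z)        ≈⟨ \\-leftDividesʳ p z ⟩
    z                     ∎

  central-to-end : ∀ {z} → IsCentral z → ∀ x y → x ∙ z ∙ y ≈ x ∙ y ∙ z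
  central-to-end {z} central-z x y = begin
    x ∙ z ∙ y      ≈⟨ assoc _ _ _ ⟩
    x ∙ (z ∙ y)    ≈⟨ ∙-congˡ (central-z y) ⟩
    x ∙ (y ∙ z)    ≈⟨ assoc _ _ _ ⟨
    x ∙ y ∙ z      ∎

  commutator-swap : ∀ x y → IsCentral ⁅ x , y ⁆ → x ∙ y ∙ (x ⁻¹ ∙ y ⁻¹) ≈ ⁅ x , y ⁆
  commutator-swap x y central-xy =
    central-swap central-xy (assoc (x ⁻¹ ∙ y ⁻¹) x y)

  stabiliser-in-subgroup : ∀ {p} {N : Carrier → Set p} → GroupTheory.IsNormalSubgroup G N →
                           ∀ v x → N ((v ∙ x) ⁻¹ ∙ v) → N x
  stabiliser-in-subgroup normal v x h =
    N-resp (trans (⁻¹-cong (≈x⁻¹)) (⁻¹-involutive x)) (N-⁻¹ h)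
    where
    open GroupTheory.IsNormalSubgroup normal using (N-resp; N-⁻¹)
    ≈x⁻¹ : (v ∙ x) ⁻¹ ∙ v ≈ x ⁻¹
    ≈x⁻¹ = begin
      (v ∙ x) ⁻¹ ∙ v      ≈⟨ ∙-congʳ (⁻¹-anti-homo-∙ v x) ⟩
      x ⁻¹ ∙ v ⁻¹ ∙ v     ≈⟨ //-rightDividesˡ v (x ⁻¹) ⟩
      x ⁻¹                ∎
      where open GroupProperties G using (⁻¹-anti-homo-∙)

module Voltages {c ℓ p} (G : Group c ℓ) (N : Group.Carrier G → Set p)
                {k : ℕ} (S : Fin k → Group.Carrier G) where
  open Group G
  open GroupTheory G
  open Quotient N
  open Gens S
  open ContainsEdge
  open GroupLemmas G
  open GroupProperties G using (y≈x\\z; ⁻¹-involutive)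
  open SetoidReasoning setoid

  Π-++ : ∀ xs ys → Π (xs ++ ys) ≈ Π xs ∙ Π ys
  Π-++ []       ys = sym (identityˡ (Π ys))
  Π-++ (x ∷ xs) ys = trans (∙-congˡ (Π-++ xs ys)) (sym (assoc _ _ _))

  closed-voltage∈N : IsNormalSubgroup N → ∀ {v w} → (v ∙ Π w) ~ v → N (Π w)
  closed-voltage∈N normal {v} {w} = stabiliser-in-subgroup normal v (Π w)

  rotation : ∀ {w pre t post} → IsCentral (Π w) → w ≡ pre ++ t ∷ post →
             Π post ∙ Π pre ≈ val t ⁻¹ ∙ Π w
  rotation {w} {pre} {t} {post} central-w split =
    y≈x\\z (val t) (Π post ∙ Π pre) (Π w) (begin
      val t ∙ (Π post ∙ Π pre)    ≈⟨ assoc _ _ _ ⟨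
      Π (t ∷ post) ∙ Π pre        ≈⟨ central-swap central-w w≈pre·rest ⟩
      Π w                         ∎)
    where
    w≈pre·rest : Π w ≈ Π pre ∙ Π (t ∷ post)
    w≈pre·rest = trans (reflexive (cong Π split)) (Π-++ pre (t ∷ post))

  module _ {v₁ w₁ x₁ v₂ w₂ x₂} {s : Fin k} (a : Fin k)
           (e₁ : ContainsEdge v₁ w₁ x₁ (s , true))
           (e₂ : ContainsEdge v₂ w₂ x₂ (s , false)) where

    connSum-shape : Π (connSum a e₁ e₂) ≈
                    S a ∙ (Π (post e₂) ∙ Π (pre e₂)) ∙ (S a ⁻¹ ∙ (Π (post e₁) ∙ Π (pre e₁)))
    connSum-shape = begin
      S a ∙ Π (post e₂ ++ pre e₂ ++ rest)       ≈⟨ ∙-congˡ (Π-++ (post e₂) _) ⟩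
      S a ∙ (Q₂ ∙ Π (pre e₂ ++ rest))           ≈⟨ ∙-congˡ (∙-congˡ (Π-++ (pre e₂) _)) ⟩
      S a ∙ (Q₂ ∙ (P₂ ∙ Π rest))                ≈⟨ ∙-congˡ (assoc _ _ _) ⟨
      S a ∙ (Q₂ ∙ P₂ ∙ Π rest)                  ≈⟨ assoc _ _ _ ⟨
      S a ∙ (Q₂ ∙ P₂) ∙ Π rest                  ≈⟨ ∙-congˡ (∙-congˡ (Π-++ (post e₁) _)) ⟩
      S a ∙ (Q₂ ∙ P₂) ∙ (S a ⁻¹ ∙ (Q₁ ∙ P₁))    ∎
      where
      rest = (a , false) ∷ post e₁ ++ pre e₁
      P₁ = Π (pre e₁)
      Q₁ = Π (post e₁)
      P₂ = Π (pre e₂)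
      Q₂ = Π (post e₂)

    connSum-voltage : IsCentral (Π w₁) → IsCentral (Π w₂) → IsCentral ⁅ S a , S s ⁆ →
                      Π (connSum a e₁ e₂) ≈ Π w₁ ∙ Π w₂ ∙ ⁅ S a , S s ⁆
    connSum-voltage central₁ central₂ central-as = begin
      Π (connSum a e₁ e₂)                              ≈⟨ connSum-shape ⟩
      S a ∙ (Π (post e₂) ∙ Π (pre e₂)) ∙ (S a ⁻¹ ∙ (Π (post e₁) ∙ Π (pre e₁)))
                                                       ≈⟨ ∙-cong (∙-congˡ rotated₂) (∙-congˡ rotated₁) ⟩
      S a ∙ (S s ∙ z₂) ∙ (S a ⁻¹ ∙ (S s ⁻¹ ∙ z₁))      ≈⟨ ∙-cong (assoc _ _ _) (assoc _ _ _) ⟨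
      S a ∙ S s ∙ z₂ ∙ (S a ⁻¹ ∙ S s ⁻¹ ∙ z₁)          ≈⟨ central-to-end central₂ _ _ ⟩
      S a ∙ S s ∙ (S a ⁻¹ ∙ S s ⁻¹ ∙ z₁) ∙ z₂          ≈⟨ ∙-congʳ (assoc _ _ _) ⟨
      S a ∙ S s ∙ (S a ⁻¹ ∙ S s ⁻¹) ∙ z₁ ∙ z₂          ≈⟨ ∙-congʳ (∙-congʳ (commutator-swap (S a) (S s) central-as)) ⟩
      ⁅ S a , S s ⁆ ∙ z₁ ∙ z₂                          ≈⟨ assoc _ _ _ ⟩
      ⁅ S a , S s ⁆ ∙ (z₁ ∙ z₂)                        ≈⟨ central-as (z₁ ∙ z₂) ⟩
      z₁ ∙ z₂ ∙ ⁅ S a , S s ⁆                          ∎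
      where
      z₁ = Π w₁
      z₂ = Π w₂
      rotated₁ : Π (post e₁) ∙ Π (pre e₁) ≈ S s ⁻¹ ∙ z₁
      rotated₁ = rotation central₁ (split e₁)
      rotated₂ : Π (post e₂) ∙ Π (pre e₂) ≈ S s ∙ z₂
      rotated₂ = trans (rotation central₂ (split e₂)) (∙-congʳ (⁻¹-involutive (S s)))

lemma5p2 : ∀ {c ℓ p} (G : Group c ℓ) →
    let open Group G
        open GroupTheory G
    in
    IsFinite → IsNilpotent →
    (N : Carrier → Set p) → IsNormalSubgroup N → IsCyclic N → (∀ x → γ 1 x → N x) →
    let open Quotient N in
    (k : ℕ) (S : Fin k → Carrier) →
    let open Gens S in
    IsMinimalGeneratingSet → (∀ i j → S i ~ S j → i ≡ j) → 2 ≤ k →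
    (v₁ : Carrier) (w₁ : List Step) (v₂ : Carrier) (w₂ : List Step) →
    IsOrientedCycle v₁ w₁ → IsOrientedCycle v₂ w₂ → Disjoint v₁ w₁ v₂ w₂ →
    (g : Carrier) (a s : Fin k) →
    (e₁ : ContainsEdge v₁ w₁ g (s , true)) →
    (e₂ : ContainsEdge v₂ w₂ (g ∙ S s ∙ S a) (s , false)) →
    (∀ x → N x → IsCentral x) →
    Π (connSum a e₁ e₂) ≈ Π w₁ ∙ Π w₂ ∙ ⁅ S a , S s ⁆
lemma5p2 G _ _ N normal _ G′⊆N _ S _ _ _ _ _ _ _ C₁ C₂ _ _ a s e₁ e₂ N⊆Z =
  connSum-voltage a e₁ e₂ (central-voltage C₁) (central-voltage C₂) central-commutator
  where
  open Group G
  open GroupTheory G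
  open Voltages G N S
  open Quotient.Gens N S using (IsOrientedCycle; Π)

  -- cycles are closed walks, so their voltages lie in N ⊆ Z(G)
  central-voltage : ∀ {v w} → IsOrientedCycle v w → IsCentral (Π w)
  central-voltage {w = w} C = N⊆Z (Π w) (closed-voltage∈N normal {w = w} (IsOrientedCycle.closed C))

  -- [a,s] ∈ G′ ⊆ N ⊆ Z(G)
  central-commutator : IsCentral ⁅ S a , S s ⁆
  central-commutator = N⊆Z _ (G′⊆N _ (gen (S a , S s , _ , refl)))
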